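{- Let $D=(V,A)$ be a digraph of order $n$. Then Min-Greedy always finds an acyclic set in $D$ of size at least $\sum_{v\in V}\left(d^+(v)+1\right)^{ -1}$, where $d^+(v)$ is the outdegree of $v$ in $D$.
   Context: A digraph $D=(V,A)$ consists of a finite vertex set $V$ and an irreflexive relation $A\subseteq V\times V$ (the arcs); its order is $|V|$. For a vertex $v$, its out-neighborhood is $N^+(v)=\{u\in V\setminus\{v\} : (v,u)\in A\}$ and its outdegree is $d^+(v)=|N^+(v)|$; when computed in a digraph $D_i$ these are written $N^+_{D_i}(v)$, $d^+_{D_i}(v)$. For $U\subseteq V$, the induced subdigraph $D[U]$ has vertex set $U$ and arc set $A\cap(U\times U)$. A cycle is a sequence of $k\ge 1$ arcs $(v_1,w_1)\cdots(v_k,w_k)$ with $w_i=v_{i+1}$ for $1\le i<k$, all $v_i$ distinct, and $w_k=v_1$ (so a pair of opposite arcs is a cycle). $U\subseteq V$ is an acyclic set if $D[U]$ has no cycle. Min-Greedy: start with $D_1=D$; while $D_i$ has a nonempty vertex set, choose a vertex $v_i$ of minimum outdegree in $D_i$ (ties broken arbitrarily), and let $D_{i+1}$ be obtained from $D_i$ by deleting $v_i$ together with $N^+_{D_i}(v_i)$. The output is the set $S=\{v_1,\dots,v_r\}$ of all chosen vertices (this set is an acyclic set of $D$). -}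

module Defs where

open import Data.Nat using (ℕ; zero; suc; _≤_)
open import Data.Bool using (Bool; true; false; _∧_; if_then_else_)
open import Data.Fin using (Fin; zero; suc; inject₁; fromℕ; _≟_)
open import Data.Fin.Subset using (Subset; _∈_; _∪_; _─_; ⁅_⁆; ∣_∣; ⊥; Empty; outside)
open import Data.Vec using (tabulate; lookup)
open import Data.Integer using (+_)
open import Data.Rational using (ℚ; _/_; 0ℚ; _+_)
open import Data.Product using (Σ; _×_)
open import Function.Definitions using (Injective)
open import Relation.Binary.PropositionalEquality using (_≡_)
open import Relation.Nullary using (¬_)
open import Relation.Nullary.Decidable using (⌊_⌋)

-- A digraph on vertex set Fin n is given by its arc relation as a Boolean
-- adjacency function: (v , u) is an arc iff Arc v u ≡ true.
Arcs : ℕ → Set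
Arcs n = Fin n → Fin n → Bool

Irreflexive : ∀ {n} → Arcs n → Set
Irreflexive {n} A = (v : Fin n) → A v v ≡ false

N⁺ : ∀ {n} → Arcs n → Subset n → Fin n → Subset n
N⁺ A U v = tabulate λ u → if ⌊ u ≟ v ⌋ then outside else (lookup U u ∧ A v u)

d⁺ : ∀ {n} → Arcs n → Subset n → Fin n → ℕ
d⁺ A U v = ∣ N⁺ A U v ∣

-- A cycle of length k+1 ≥ 1 inside U: distinct vertices f 0, …, f k, all in U,
-- with arcs f i → f (i+1) for i < k and f k → f 0.
record Cycle {n} (A : Arcs n) (U : Subset n) : Set where
  field
    k      : ℕ
    f      : Fin (suc k) → Fin n
    inj    : Injective _≡_ _≡_ f
    inU    : (i : Fin (suc k)) → f i ∈ U
    arcs   : (i : Fin k) → A (f (inject₁ i)) (f (suc i)) ≡ true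
    closes : A (f (fromℕ k)) (f zero) ≡ true

Acyclic : ∀ {n} → Arcs n → Subset n → Set
Acyclic A U = ¬ Cycle A U

-- MinGreedy A U S : running Min-Greedy on D[U] (with some choice of tie
-- breaking) terminates with output set S of chosen vertices.
data MinGreedy {n} (A : Arcs n) : Subset n → Subset n → Set where
  stop : ∀ {U} → Empty U → MinGreedy A U ⊥
  step : ∀ {U S} (v : Fin n) → v ∈ U →
         ((u : Fin n) → u ∈ U → d⁺ A U v ≤ d⁺ A U u) →
         MinGreedy A (U ─ (⁅ v ⁆ ∪ N⁺ A U v)) S →
         MinGreedy A U (⁅ v ⁆ ∪ S)

Σℚ : ∀ {n} → (Fin n → ℚ) → ℚ
Σℚ {zero} g = 0ℚ
Σℚ {suc n} g = g zero + Σℚ {n} (λ i → g (suc i))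

caroWeiBound : ∀ {n} → Arcs n → Subset n → ℚ
caroWeiBound A V = Σℚ λ v → (+ 1) / suc (d⁺ A V v)

-- Weigh each vertex u by 1/(d⁺(u)+1), the outdegree taken in the whole digraph.
-- When Min-Greedy picks v in the current digraph D[U] it deletes v and its
-- d = d⁺_U(v) out-neighbours; all of these have outdegree at least d in D[U],
-- hence in D, so together they weigh at most (d+1)/(d+1) = 1. Each chosen vertex
-- therefore removes at most weight 1, and the total weight is at most |S|.
-- For acyclicity: a cycle inside S passes through the vertex v chosen first and
-- continues to some w ≠ v (irreflexivity) in S with v → w; but w was chosen
-- later, i.e. survived the step of v, which deleted every out-neighbour of v.

module Submission where

open import Defs
open import Data.Fin.Subset using (Subset; ⊤; ∣_∣)
open import Data.Integer using (+_)
open import Data.Rational using (_/_; _≤_)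
open import Data.Product using (_×_)

open import Data.Nat as ℕ using (ℕ; zero; suc)
import Data.Nat.Properties as ℕ
open import Data.Bool using (true; _∧_; if_then_else_)
open import Data.Fin using (Fin; zero; suc; _≟_)
open import Data.Fin.Properties using (any?)
open import Data.Fin.Relation.Unary.Top using (view; ‵fromℕ; ‵inject₁)
open import Data.Fin.Subset
  using (_∈_; _∉_; _⊆_; _─_; _∪_; ⁅_⁆; ⊥; inside; outside)
open import Data.Fin.Subset.Properties
  using (drop-∷-⊆; ∪-identityˡ; x∈p∪q⁻; x∈p∪q⁺; x∈⁅x⁆; x∈⁅y⁆⇒x≡y; p─q⊆p; ⊆-refl; ⊆-trans;
         p⊆q⇒∣p∣≤∣q∣; ⊥⊆; ∉⊥; Empty-unique; ∣⊥∣≡0)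
import Data.Integer as ℤ
import Data.Integer.Properties as ℤ
open import Data.Rational as ℚ using (ℚ; toℚᵘ)
import Data.Rational.Properties as ℚ
open import Data.Rational.Unnormalised as ℚᵘ using (ℚᵘ; 0ℚᵘ; 1ℚᵘ; *≤*; *≡*)
  renaming (_≤_ to _≤ᵘ_; _≃_ to _≃ᵘ_; _+_ to _+ᵘ_; _/_ to _/ᵘ_)
import Data.Rational.Unnormalised.Properties as ℚᵘ
open import Data.Vec using ([]; _∷_; lookup)
open import Data.Vec.Base using (here; there)
open import Data.Vec.Properties using ([]=⇒lookup; lookup⇒[]=; lookup∘tabulate)
open import Data.Product using (∃; _,_; proj₁; proj₂)
open import Data.Sum using ([_,_]; inj₁; inj₂)
open import Data.Empty using (⊥-elim)
open import Function using (_∘_; id)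
open import Relation.Nullary using (yes; no; contradiction)
open import Relation.Nullary.Decidable using (⌊_⌋)
open import Relation.Binary.PropositionalEquality
  using (_≡_; _≢_; refl; sym; trans; cong; subst; subst₂; module ≡-Reasoning)

p/d+q/d≃[p+q]/d : ∀ p q d → p /ᵘ suc d +ᵘ q /ᵘ suc d ≃ᵘ (p ℤ.+ q) /ᵘ suc d
p/d+q/d≃[p+q]/d p q d = *≡* (begin
  (p ℤ.* D ℤ.+ q ℤ.* D) ℤ.* D        ≡⟨ cong (ℤ._* D) (ℤ.*-distribʳ-+ D p q) ⟨
  (p ℤ.+ q) ℤ.* D ℤ.* D              ≡⟨ ℤ.*-assoc (p ℤ.+ q) D D ⟩
  (p ℤ.+ q) ℤ.* (D ℤ.* D)            ≡⟨ cong ((p ℤ.+ q) ℤ.*_) (ℤ.pos-* (suc d) (suc d)) ⟨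
  (p ℤ.+ q) ℤ.* + (suc d ℕ.* suc d)  ∎)
  where
  open ≡-Reasoning
  D : ℤ.ℤ
  D = + suc d

n/n≃1 : ∀ n → + suc n /ᵘ suc n ≃ᵘ 1ℚᵘ
n/n≃1 n = *≡* (trans (ℤ.*-identityʳ (+ suc n)) (sym (ℤ.*-identityˡ (+ suc n))))

1/[1+n]≤1/[1+m] : ∀ {m n} → m ℕ.≤ n → + 1 /ᵘ suc n ≤ᵘ + 1 /ᵘ suc m
1/[1+n]≤1/[1+m] {m} {n} m≤n = *≤* (subst₂ ℤ._≤_
  (sym (ℤ.*-identityˡ (+ suc m))) (sym (ℤ.*-identityˡ (+ suc n))) (ℤ.+≤+ (ℕ.s≤s m≤n)))

Σ∈ : ∀ {n} → Subset n → (Fin n → ℚᵘ) → ℚᵘ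
Σ∈ []            w = 0ℚᵘ
Σ∈ (inside  ∷ U) w = w zero +ᵘ Σ∈ U (w ∘ suc)
Σ∈ (outside ∷ U) w = Σ∈ U (w ∘ suc)

Σ∈-⊥ : ∀ {n} (w : Fin n → ℚᵘ) → Σ∈ ⊥ w ≡ 0ℚᵘ
Σ∈-⊥ {zero}  w = refl
Σ∈-⊥ {suc n} w = Σ∈-⊥ (w ∘ suc)

Σ∈-─ : ∀ {n} {R U : Subset n} (w : Fin n → ℚᵘ) → R ⊆ U → Σ∈ U w ≃ᵘ Σ∈ R w +ᵘ Σ∈ (U ─ R) w
Σ∈-─ {R = []} {[]} w R⊆U = ℚᵘ.≃-sym (ℚᵘ.+-identityˡ 0ℚᵘ)
Σ∈-─ {R = inside ∷ R} {outside ∷ U} w R⊆U with R⊆U here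
... | ()
Σ∈-─ {R = inside ∷ R} {inside ∷ U} w R⊆U = begin-equality
  a +ᵘ Σ∈ U (w ∘ suc)  ≃⟨ ℚᵘ.+-congʳ a (Σ∈-─ (w ∘ suc) (drop-∷-⊆ R⊆U)) ⟩
  a +ᵘ (b +ᵘ c)         ≃⟨ ℚᵘ.+-assoc a b c ⟨
  a +ᵘ b +ᵘ c           ∎
  where
  open ℚᵘ.≤-Reasoning
  a b c : ℚᵘ
  a = w zero
  b = Σ∈ R (w ∘ suc)
  c = Σ∈ (U ─ R) (w ∘ suc)
Σ∈-─ {R = outside ∷ R} {inside ∷ U} w R⊆U = begin-equality
  a +ᵘ Σ∈ U (w ∘ suc)  ≃⟨ ℚᵘ.+-congʳ a (Σ∈-─ (w ∘ suc) (drop-∷-⊆ R⊆U)) ⟩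
  a +ᵘ (b +ᵘ c)         ≃⟨ ℚᵘ.+-assoc a b c ⟨
  a +ᵘ b +ᵘ c           ≃⟨ ℚᵘ.+-congˡ c (ℚᵘ.+-comm a b) ⟩
  b +ᵘ a +ᵘ c           ≃⟨ ℚᵘ.+-assoc b a c ⟩
  b +ᵘ (a +ᵘ c)         ∎
  where
  open ℚᵘ.≤-Reasoning
  a b c : ℚᵘ
  a = w zero
  b = Σ∈ R (w ∘ suc)
  c = Σ∈ (U ─ R) (w ∘ suc)
Σ∈-─ {R = outside ∷ R} {outside ∷ U} w R⊆U = Σ∈-─ (w ∘ suc) (drop-∷-⊆ R⊆U)

Σ∈-mono-≤ : ∀ {n} (R : Subset n) {w w′ : Fin n → ℚᵘ} →
            (∀ {u} → u ∈ R → w u ≤ᵘ w′ u) → Σ∈ R w ≤ᵘ Σ∈ R w′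
Σ∈-mono-≤ []            w≤w′ = ℚᵘ.≤-refl
Σ∈-mono-≤ (inside  ∷ R) w≤w′ = ℚᵘ.+-mono-≤ (w≤w′ here) (Σ∈-mono-≤ R (w≤w′ ∘ there))
Σ∈-mono-≤ (outside ∷ R) w≤w′ = Σ∈-mono-≤ R (w≤w′ ∘ there)

Σ∈-unitFraction : ∀ {n} (R : Subset n) d → Σ∈ R (λ _ → + 1 /ᵘ suc d) ≃ᵘ + ∣ R ∣ /ᵘ suc d
Σ∈-unitFraction []            d = *≡* refl
Σ∈-unitFraction (inside  ∷ R) d =
  ℚᵘ.≃-trans (ℚᵘ.+-congʳ _ (Σ∈-unitFraction R d)) (p/d+q/d≃[p+q]/d (+ 1) (+ ∣ R ∣) d)
Σ∈-unitFraction (outside ∷ R) d = Σ∈-unitFraction R d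

x∧y≡true⇒x≡true×y≡true : ∀ {x y} → x ∧ y ≡ true → x ≡ true × y ≡ true
x∧y≡true⇒x≡true×y≡true {true} y≡true = refl , y≡true

x∈p─q⇒x∉q : ∀ {n} {x : Fin n} (p q : Subset n) → x ∈ p ─ q → x ∉ q
x∈p─q⇒x∉q (_ ∷ p) (outside ∷ q) here       ()
x∈p─q⇒x∉q (_ ∷ p) (_       ∷ q) (there x∈) (there x∈q) = x∈p─q⇒x∉q p q x∈ x∈q

x∈⁅y⁆∪p∧x≢y⇒x∈p : ∀ {n} {x y : Fin n} {p} → x ∈ ⁅ y ⁆ ∪ p → x ≢ y → x ∈ p
x∈⁅y⁆∪p∧x≢y⇒x∈p {y = y} {p} x∈ x≢y =
  [ (λ x∈⁅y⁆ → contradiction (x∈⁅y⁆⇒x≡y y x∈⁅y⁆) x≢y) , id ] (x∈p∪q⁻ ⁅ y ⁆ p x∈)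

⁅x⁆∪p⊆q : ∀ {n} {x : Fin n} {p q} → x ∈ q → p ⊆ q → ⁅ x ⁆ ∪ p ⊆ q
⁅x⁆∪p⊆q {x = x} {p} {q} x∈q p⊆q y∈ =
  [ (λ y∈⁅x⁆ → subst (_∈ q) (sym (x∈⁅y⁆⇒x≡y x y∈⁅x⁆)) x∈q) , p⊆q ] (x∈p∪q⁻ ⁅ x ⁆ p y∈)

∣⁅x⁆∪p∣≡1+∣p∣ : ∀ {n} (x : Fin n) (p : Subset n) → x ∉ p → ∣ ⁅ x ⁆ ∪ p ∣ ≡ suc ∣ p ∣
∣⁅x⁆∪p∣≡1+∣p∣ zero    (inside  ∷ p) x∉p = ⊥-elim (x∉p here)
∣⁅x⁆∪p∣≡1+∣p∣ zero    (outside ∷ p) _   = cong (suc ∘ ∣_∣) (∪-identityˡ p)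
∣⁅x⁆∪p∣≡1+∣p∣ (suc x) (inside  ∷ p) x∉p = cong suc (∣⁅x⁆∪p∣≡1+∣p∣ x p (x∉p ∘ there))
∣⁅x⁆∪p∣≡1+∣p∣ (suc x) (outside ∷ p) x∉p = ∣⁅x⁆∪p∣≡1+∣p∣ x p (x∉p ∘ there)

module _ {n} (A : Arcs n) where

  ∈N⁺⁻ : ∀ {U v u} → u ∈ N⁺ A U v → u ≢ v × u ∈ U × A v u ≡ true
  ∈N⁺⁻ {U} {v} {u} u∈ with u ≟ v | trans (sym (lookup∘tabulate _ u)) ([]=⇒lookup u∈)
  ... | yes _  | ()
  ... | no u≢v | entry =
    let u∈U , arc = x∧y≡true⇒x≡true×y≡true entry in u≢v , lookup⇒[]= u U u∈U , arc

  ∈N⁺⁺ : ∀ {U v u} → u ≢ v → u ∈ U → A v u ≡ true → u ∈ N⁺ A U v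
  ∈N⁺⁺ {U} {v} {u} u≢v u∈U arc = lookup⇒[]= u (N⁺ A U v) (trans (lookup∘tabulate _ u) entry)
    where
    entry : (if ⌊ u ≟ v ⌋ then outside else (lookup U u ∧ A v u)) ≡ true
    entry with u ≟ v
    ... | yes u≡v = contradiction u≡v u≢v
    ... | no _ rewrite []=⇒lookup u∈U | arc = refl

  N⁺⊆ : ∀ U v → N⁺ A U v ⊆ U
  N⁺⊆ U v = proj₁ ∘ proj₂ ∘ ∈N⁺⁻

  v∉N⁺ : ∀ U v → v ∉ N⁺ A U v
  v∉N⁺ U v v∈ = proj₁ (∈N⁺⁻ {U} v∈) refl

  d⁺-mono : ∀ {U W} → U ⊆ W → ∀ v → d⁺ A U v ℕ.≤ d⁺ A W v
  d⁺-mono U⊆W v = p⊆q⇒∣p∣≤∣q∣ λ u∈ →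
    let u≢v , u∈U , arc = ∈N⁺⁻ u∈ in ∈N⁺⁺ u≢v (U⊆W u∈U) arc

  closedN⁺ : Subset n → Fin n → Subset n
  closedN⁺ U v = ⁅ v ⁆ ∪ N⁺ A U v

  v∈closedN⁺ : ∀ U v → v ∈ closedN⁺ U v
  v∈closedN⁺ U v = x∈p∪q⁺ (inj₁ (x∈⁅x⁆ v))

  closedN⁺⊆ : ∀ {U v} → v ∈ U → closedN⁺ U v ⊆ U
  closedN⁺⊆ {U} {v} v∈U = ⁅x⁆∪p⊆q v∈U (N⁺⊆ U v)

  ∣closedN⁺∣ : ∀ U v → ∣ closedN⁺ U v ∣ ≡ suc (d⁺ A U v)
  ∣closedN⁺∣ U v = ∣⁅x⁆∪p∣≡1+∣p∣ v (N⁺ A U v) (v∉N⁺ U v)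

  ¬arc-to-remainder : ∀ {U v w} → w ∈ U ─ closedN⁺ U v → A v w ≢ true
  ¬arc-to-remainder {U} {v} {w} w∈ arc = w∉R (x∈p∪q⁺ (inj₂ (∈N⁺⁺ w≢v (p─q⊆p U R w∈) arc)))
    where
    R = closedN⁺ U v
    w∉R : w ∉ R
    w∉R = x∈p─q⇒x∉q U R w∈
    w≢v : w ≢ v
    w≢v refl = w∉R (v∈closedN⁺ U v)

  MinGreedy⇒⊆ : ∀ {U S} → MinGreedy A U S → S ⊆ U
  MinGreedy⇒⊆ (stop _)             = ⊥⊆
  MinGreedy⇒⊆ (step v v∈U _ run) = ⁅x⁆∪p⊆q v∈U (⊆-trans (MinGreedy⇒⊆ run) (p─q⊆p _ _))

  successor : ∀ {U} (C : Cycle A U) (i : Fin (suc (Cycle.k C))) →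
              ∃ λ j → A (Cycle.f C i) (Cycle.f C j) ≡ true
  successor C i with view i
  ... | ‵fromℕ     = zero , Cycle.closes C
  ... | ‵inject₁ j = suc j , Cycle.arcs C j

  Cycle-restrict : ∀ {U W} (C : Cycle A U) → (∀ i → Cycle.f C i ∈ W) → Cycle A W
  Cycle-restrict C inW = record
    { k = k ; f = f ; inj = inj ; inU = inW ; arcs = arcs ; closes = closes }
    where open Cycle C

  MinGreedy⇒Acyclic : Irreflexive A → ∀ {U S} → MinGreedy A U S → Acyclic A S
  MinGreedy⇒Acyclic irr (stop _) C = ∉⊥ (Cycle.inU C zero)
  MinGreedy⇒Acyclic irr (step {S = S′} v _ _ run) C with any? (λ i → Cycle.f C i ≟ v)
  ... | yes (i , fᵢ≡v) = ¬arc-to-remainder (MinGreedy⇒⊆ run w∈S′) v→w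
    where
    j : Fin (suc (Cycle.k C))
    j = proj₁ (successor C i)
    w : Fin n
    w = Cycle.f C j
    v→w : A v w ≡ true
    v→w = subst (λ u → A u w ≡ true) fᵢ≡v (proj₂ (successor C i))
    w≢v : w ≢ v
    w≢v w≡v = contradiction (trans (sym (irr v)) (subst (λ u → A v u ≡ true) w≡v v→w)) λ ()
    w∈S′ : w ∈ S′
    w∈S′ = x∈⁅y⁆∪p∧x≢y⇒x∈p (Cycle.inU C j) w≢v
  ... | no v∉C = MinGreedy⇒Acyclic irr run
    (Cycle-restrict C λ i → x∈⁅y⁆∪p∧x≢y⇒x∈p (Cycle.inU C i) (v∉C ∘ (i ,_)))

  weight : Subset n → Fin n → ℚᵘ
  weight W u = + 1 /ᵘ suc (d⁺ A W u)

  Σweight≤∣S∣ : ∀ {W U S} → U ⊆ W → MinGreedy A U S → Σ∈ U (weight W) ≤ᵘ + ∣ S ∣ /ᵘ 1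
  Σweight≤∣S∣ {W} _ (stop U-empty) rewrite Empty-unique U-empty = ℚᵘ.≤-reflexive-≡
    (trans (Σ∈-⊥ (weight W)) (cong (λ k → + k /ᵘ 1) (sym (∣⊥∣≡0 n))))
  Σweight≤∣S∣ {W} {U} U⊆W (step {S = S′} v v∈U minimal run) = begin
    Σ∈ U (weight W)                              ≃⟨ Σ∈-─ (weight W) R⊆U ⟩
    Σ∈ R (weight W) +ᵘ Σ∈ (U ─ R) (weight W)     ≤⟨ ℚᵘ.+-mono-≤ (Σ∈-mono-≤ R light) (Σweight≤∣S∣ U─R⊆W run) ⟩
    Σ∈ R (λ _ → + 1 /ᵘ suc d) +ᵘ + ∣ S′ ∣ /ᵘ 1   ≃⟨ ℚᵘ.+-congˡ (+ ∣ S′ ∣ /ᵘ 1) (Σ∈-unitFraction R d) ⟩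
    + ∣ R ∣ /ᵘ suc d +ᵘ + ∣ S′ ∣ /ᵘ 1             ≡⟨ cong (λ k → + k /ᵘ suc d +ᵘ + ∣ S′ ∣ /ᵘ 1) (∣closedN⁺∣ U v) ⟩
    + suc d /ᵘ suc d +ᵘ + ∣ S′ ∣ /ᵘ 1             ≃⟨ ℚᵘ.+-congˡ (+ ∣ S′ ∣ /ᵘ 1) (n/n≃1 d) ⟩
    1ℚᵘ +ᵘ + ∣ S′ ∣ /ᵘ 1                          ≃⟨ p/d+q/d≃[p+q]/d (+ 1) (+ ∣ S′ ∣) 0 ⟩
    + suc ∣ S′ ∣ /ᵘ 1                             ≡⟨ cong (λ k → + k /ᵘ 1) (∣⁅x⁆∪p∣≡1+∣p∣ v S′ v∉S′) ⟨
    + ∣ ⁅ v ⁆ ∪ S′ ∣ /ᵘ 1                          ∎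
    where
    open ℚᵘ.≤-Reasoning
    d : ℕ
    d = d⁺ A U v
    R : Subset n
    R = closedN⁺ U v
    R⊆U : R ⊆ U
    R⊆U = closedN⁺⊆ v∈U
    U─R⊆W : U ─ R ⊆ W
    U─R⊆W = ⊆-trans (p─q⊆p U R) U⊆W
    light : ∀ {u} → u ∈ R → weight W u ≤ᵘ + 1 /ᵘ suc d
    light {u} u∈R = 1/[1+n]≤1/[1+m] (ℕ.≤-trans (minimal u (R⊆U u∈R)) (d⁺-mono U⊆W u))
    v∉S′ : v ∉ S′
    v∉S′ v∈S′ = x∈p─q⇒x∉q U R (MinGreedy⇒⊆ run v∈S′) (v∈closedN⁺ U v)

toℚᵘ-Σℚ : ∀ {n} (g : Fin n → ℚ) → toℚᵘ (Σℚ g) ≃ᵘ Σ∈ ⊤ (toℚᵘ ∘ g)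
toℚᵘ-Σℚ {zero}  g = *≡* refl
toℚᵘ-Σℚ {suc n} g = ℚᵘ.≃-trans (ℚ.toℚᵘ-homo-+ (g zero) (Σℚ (g ∘ suc)))
                               (ℚᵘ.+-congʳ (toℚᵘ (g zero)) (toℚᵘ-Σℚ (g ∘ suc)))

theorem4 : (n : ℕ) (A : Arcs n) → Irreflexive A →
           (S : Subset n) → MinGreedy A ⊤ S →
           Acyclic A S × caroWeiBound A ⊤ ≤ (+ ∣ S ∣) / 1
theorem4 n A irr S run = MinGreedy⇒Acyclic A irr run , ℚ.toℚᵘ-cancel-≤ (begin
  toℚᵘ (caroWeiBound A ⊤)                  ≃⟨ toℚᵘ-Σℚ (λ v → + 1 / suc (d⁺ A ⊤ v)) ⟩
  -- ℚ's  + 1 / suc d  is by definition  fromℚᵘ (+ 1 /ᵘ suc d)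
  Σ∈ ⊤ (λ v → toℚᵘ (+ 1 / suc (d⁺ A ⊤ v)))  ≤⟨ Σ∈-mono-≤ ⊤ (λ {v} _ → ℚᵘ.≤-reflexive (ℚ.toℚᵘ-fromℚᵘ (weight A ⊤ v))) ⟩
  Σ∈ ⊤ (weight A ⊤)                        ≤⟨ Σweight≤∣S∣ A ⊆-refl run ⟩
  + ∣ S ∣ /ᵘ 1                              ≃⟨ ℚ.toℚᵘ-fromℚᵘ (+ ∣ S ∣ /ᵘ 1) ⟨
  toℚᵘ (+ ∣ S ∣ / 1)                         ∎)
  where open ℚᵘ.≤-Reasoning
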